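{- Let $q$ be a power of an odd prime and let $G$ and $H$ be labeled graphs over $\mathbf{F}_q$ on the vertex set $\{1,\dots,n\}$. For every vertex $i$: (i) for all nonzero $b_1,b_2,b_3,b_4\in\mathbf{F}_q$, the map $\phi\mapsto\phi\times(f_{b_1,i},f_{b_2,i},f_{b_3,i},f_{b_4,i})$ is a bijection of $\mathbf{F}_q^{4n}$; (ii) for every nonzero $b\in\mathbf{F}_q$, $\lambda(G\circ_b i,H)^{\perp}=\lambda(G,H)^{\perp}\times(f_{b^{ -1},i},f_{b^{ -1},i},f_{b,i},f_{b,i})$; (iii) for every nonzero $b\in\mathbf{F}_q$, $\lambda(G,H\circ_b i)^{\perp}=\lambda(G,H)^{\perp}\times(f_{b^{ -1},i},f_{b,i},f_{b^{ -1},i},f_{b,i})$.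
   Context: A labeled graph on $\{1,\dots,n\}$ over $\mathbf{F}_q$ is a symmetric matrix $G=(g_{ij})$ with zero diagonal; its neighborhood function is $g(i)=(g_{i1},\dots,g_{in})$ (similarly $h$ for $H$). For a vertex $v$ and nonzero $b$, $G\circ_b v$ is the labeled graph $G''$ with $g''_{vj}=g''_{jv}=b\,g_{vj}$ for all $j$, $g''_{jk}=g_{jk}$ for $j,k\ne v$, zero diagonal. $e_i$ is the $i$-th standard basis vector of $\mathbf{F}_q^n$, $f_{b,i}=(1,\dots,1,b,1,\dots,1)$ (entry $b$ in position $i$), and $\times$ is the coordinatewise product (blockwise on $\mathbf{F}_q^{4n}=(\mathbf{F}_q^n)^4$); for a set $S$, $S\times w=\{s\times w:s\in S\}$. On $\mathbf{F}_q^{4n}$ use the form $\langle(X,Y,Z,T),(X',Y',Z',T')\rangle=\langle X,X'\rangle-\langle Y,Y'\rangle+\langle Z,Z'\rangle-\langle T,T'\rangle$, $\perp$ the orthogonal complement for it. $\lambda(j,k)=(g(j)\times h(k),\ g(j)\times e_k,\ e_j\times h(k),\ e_j\times e_k)$ and $\lambda(G,H)=\mathrm{Span}\{\lambda(j,k): j,k\}$. -}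

module Defs where

open import Level using (Level; _⊔_) renaming (suc to lsuc)
open import Algebra.Bundles using (CommutativeRing)
open import Data.Nat using (ℕ; zero; suc)
open import Data.Fin using (Fin; _≟_) renaming (zero to fz; suc to fs)
open import Data.Bool using (if_then_else_; _∨_)
open import Relation.Nullary using (¬_; does)
open import Data.Product using (∃; _×_)

record Field (c ℓ : Level) : Set (lsuc (c ⊔ ℓ)) where
  field
    commutativeRing : CommutativeRing c ℓ
  open CommutativeRing commutativeRing public
  field
    0≉1        : ¬ (0# ≈ 1#)
    _⁻¹        : Carrier → Carrier
    ⁻¹-inverse : ∀ x → ¬ (x ≈ 0#) → x * (x ⁻¹) ≈ 1#

module Over {c ℓ : Level} (F : Field c ℓ) where
  open Field F

  Vect : ℕ → Set c
  Vect n = Fin n → Carrier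

  -- vectors in F^{4n} = (F^n)^4, block b ∈ Fin 4, coordinate m ∈ Fin n
  Vect4 : ℕ → Set c
  Vect4 n = Fin 4 → Fin n → Carrier

  quad : ∀ {n} → Vect n → Vect n → Vect n → Vect n → Vect4 n
  quad X Y Z T fz = X
  quad X Y Z T (fs fz) = Y
  quad X Y Z T (fs (fs fz)) = Z
  quad X Y Z T (fs (fs (fs fz))) = T

  _≋₄_ : ∀ {n} → Vect4 n → Vect4 n → Set ℓ
  φ ≋₄ ψ = ∀ b m → φ b m ≈ ψ b m

  _⊙_ : ∀ {n} → Vect n → Vect n → Vect n
  (u ⊙ v) m = u m * v m

  _⊙₄_ : ∀ {n} → Vect4 n → Vect4 n → Vect4 n
  (φ ⊙₄ ψ) b m = φ b m * ψ b m

  sumF : ∀ n → (Fin n → Carrier) → Carrier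
  sumF zero    f = 0#
  sumF (suc n) f = f fz + sumF n (λ m → f (fs m))

  e : ∀ {n} → Fin n → Vect n
  e i m = if does (i ≟ m) then 1# else 0#

  fv : ∀ {n} → Carrier → Fin n → Vect n
  fv b i m = if does (i ≟ m) then b else 1#

  dot : ∀ {n} → Vect n → Vect n → Carrier
  dot {n} u v = sumF n (λ m → u m * v m)

  form : ∀ {n} → Vect4 n → Vect4 n → Carrier
  form φ ψ = ((dot (φ fz) (ψ fz) - dot (φ (fs fz)) (ψ (fs fz)))
               + dot (φ (fs (fs fz))) (ψ (fs (fs fz))))
               - dot (φ (fs (fs (fs fz)))) (ψ (fs (fs (fs fz))))

  Matrix : ℕ → Set c
  Matrix n = Fin n → Fin n → Carrier

  IsLabeledGraph : ∀ {n} → Matrix n → Set ℓ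
  IsLabeledGraph g = (∀ i j → g i j ≈ g j i) × (∀ i → g i i ≈ 0#)

  circ : ∀ {n} → Matrix n → Carrier → Fin n → Matrix n
  circ g b v j k =
    if does (j ≟ k) then 0#
    else (if does (j ≟ v) ∨ does (k ≟ v) then b * g j k else g j k)

  lam : ∀ {n} → Matrix n → Matrix n → Fin n → Fin n → Vect4 n
  lam g h j k = quad (g j ⊙ h k) (g j ⊙ e k) (e j ⊙ h k) (e j ⊙ e k)

  InLambda : ∀ {n} → Matrix n → Matrix n → Vect4 n → Set (c ⊔ ℓ)
  InLambda {n} g h v =
    ∃ λ (coef : Fin n → Fin n → Carrier) →
      v ≋₄ (λ b m → sumF n (λ j → sumF n (λ k → coef j k * lam g h j k b m)))

  InPerp : ∀ {n} → Matrix n → Matrix n → Vect4 n → Set (c ⊔ ℓ)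
  InPerp g h w = ∀ v → InLambda g h v → form w v ≈ 0#

  -- w ∈ S × u, for S given as a predicate (equality up to ≈)
  InScaled : ∀ {n} {a} → (Vect4 n → Set a) → Vect4 n → Vect4 n → Set (c ⊔ ℓ ⊔ a)
  InScaled S u w = ∃ λ φ → S φ × (w ≋₄ (φ ⊙₄ u))

  _≐_ : ∀ {n} {a} → (Vect4 n → Set a) → (Vect4 n → Set a) → Set (c ⊔ a)
  P ≐ Q = ∀ w → (P w → Q w) × (Q w → P w)

{-# OPTIONS --safe #-}
-- Because G has zero diagonal, G ∘_b i = diag(f_{b,i}) G diag(f_{b,i}). Hence every
-- generator λ(j,k) of λ(G ∘_b i, H) is a nonzero multiple of the corresponding generator of
-- λ(G,H) multiplied coordinatewise by D = (f_{b,i}, f_{b,i}, f_{b⁻¹,i}, f_{b⁻¹,i}); the last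
-- two blocks involve e_j, which diag(f_{b⁻¹,i}) only rescales. So λ(G ∘_b i, H) = λ(G,H) × D,
-- and since ⟨w, v × D⟩ = ⟨w × D, v⟩, orthogonal complements transform by the coordinatewise
-- inverse of D; part (iii) is the mirror image in H. Part (i) holds because all entries of
-- the f_{b,i} are invertible.
module Submission where

open import Defs
open import Level using (Level; _⊔_)
open import Data.Nat using (ℕ; _≤_; _^_; zero; suc)
open import Data.Nat.Primality using (Prime)
open import Data.Fin using (Fin; _≟_) renaming (zero to fz; suc to fs)
open import Data.Product using (∃; ∃₂; _×_; _,_)
open import Function using (_∘_)
open import Relation.Nullary using (¬_; yes; no)
open import Relation.Nullary.Decidable using (dec-true; dec-false)
open import Relation.Binary.PropositionalEquality using (_≡_; _≢_; setoid)
import Relation.Binary.PropositionalEquality as ≡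
open import Function.Bundles using (Bijection)
open import Function.Definitions using (Bijective)

module _ {c ℓ : Level} (F : Field c ℓ) where
  open Field F hiding (setoid)
  open Over F
  open import Relation.Binary.Reasoning.Setoid (Field.setoid F)
  open import Algebra.Properties.Semiring.Sum semiring using (sum; sum-cong-≋; *-distribʳ-sum)
  open import Algebra.Solver.CommutativeMonoid *-commutativeMonoid using (solve; _⊜_; _⊕_)

  ⁻¹-inverseˡ : ∀ {x} → ¬ (x ≈ 0#) → x ⁻¹ * x ≈ 1#
  ⁻¹-inverseˡ {x} x≉0 = trans (*-comm (x ⁻¹) x) (⁻¹-inverse x x≉0)

  *-inverseʳ-cancel : ∀ {x u u'} → u * u' ≈ 1# → (x * u) * u' ≈ x
  *-inverseʳ-cancel {x} {u} {u'} uu'≈1 = begin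
    (x * u) * u' ≈⟨ *-assoc x u u' ⟩
    x * (u * u') ≈⟨ *-congˡ uu'≈1 ⟩
    x * 1#       ≈⟨ *-identityʳ x ⟩
    x            ∎

  *-inverseˡ-cancel : ∀ {x u u'} → u * u' ≈ 1# → u' * (u * x) ≈ x
  *-inverseˡ-cancel {x} {u} {u'} uu'≈1 = begin
    u' * (u * x) ≈⟨ *-comm u' (u * x) ⟩
    (u * x) * u' ≈⟨ *-congʳ (*-comm u x) ⟩
    (x * u) * u' ≈⟨ *-inverseʳ-cancel uu'≈1 ⟩
    x            ∎

  sumF≡sum : ∀ n (f : Fin n → Carrier) → sumF n f ≡ sum f
  sumF≡sum zero    f = ≡.refl
  sumF≡sum (suc n) f = ≡.cong (f fz +_) (sumF≡sum n (f ∘ fs))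

  sumF-cong : ∀ n {f f' : Fin n → Carrier} → (∀ m → f m ≈ f' m) → sumF n f ≈ sumF n f'
  sumF-cong n {f} {f'} f≈f' rewrite sumF≡sum n f | sumF≡sum n f' = sum-cong-≋ f≈f'

  sumF-*ʳ : ∀ n (f : Fin n → Carrier) x → sumF n f * x ≈ sumF n (λ m → f m * x)
  sumF-*ʳ n f x rewrite sumF≡sum n f | sumF≡sum n (λ m → f m * x) = *-distribʳ-sum x f

  dot-congˡ : ∀ {n} {u u' : Vect n} (v : Vect n) → (∀ m → u m ≈ u' m) → dot u v ≈ dot u' v
  dot-congˡ {n} v u≈u' = sumF-cong n (λ m → *-congʳ (u≈u' m))

  dot-⊙ : ∀ {n} (u v d : Vect n) → dot u (v ⊙ d) ≈ dot (u ⊙ d) v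
  dot-⊙ {n} u v d = sumF-cong n (λ m →
    solve 3 (λ x y z → x ⊕ (y ⊕ z) ⊜ (x ⊕ z) ⊕ y) refl (u m) (v m) (d m))

  form-cong-dot : ∀ {n} {φ ψ φ' ψ' : Vect4 n}
    → (∀ β → dot (φ β) (ψ β) ≈ dot (φ' β) (ψ' β)) → form φ ψ ≈ form φ' ψ'
  form-cong-dot eq =
    +-cong (+-cong (+-cong (eq fz) (-‿cong (eq (fs fz)))) (eq (fs (fs fz))))
           (-‿cong (eq (fs (fs (fs fz)))))

  form-congˡ : ∀ {n} {w w' : Vect4 n} (v : Vect4 n) → w ≋₄ w' → form w v ≈ form w' v
  form-congˡ {w = w} {w'} v w≋w' =
    form-cong-dot {φ = w} {v} {w'} {v} (λ β → dot-congˡ (v β) (w≋w' β))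

  form-⊙ : ∀ {n} (w v D : Vect4 n) → form w (v ⊙₄ D) ≈ form (w ⊙₄ D) v
  form-⊙ w v D =
    form-cong-dot {φ = w} {v ⊙₄ D} {w ⊙₄ D} {v} (λ β → dot-⊙ (w β) (v β) (D β))

  Perp : ∀ {n a} → (Vect4 n → Set a) → Vect4 n → Set (c ⊔ ℓ ⊔ a)
  Perp S w = ∀ v → S v → form w v ≈ 0#

  Perp-⊙ : ∀ {n a} {S S' : Vect4 n → Set a} {D D' : Vect4 n}
    → (∀ {v} → S v → S' (v ⊙₄ D)) → (∀ {v} → S' v → S (v ⊙₄ D'))
    → (∀ β m → D β m * D' β m ≈ 1#)
    → Perp S' ≐ InScaled (Perp S) D'
  Perp-⊙ {S = S} {S'} {D} {D'} S⊙D⊆S' S'⊙D'⊆S DD'≈1 w = to , from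
    where
    to : Perp S' w → InScaled (Perp S) D' w
    to w⊥S' = w ⊙₄ D
            , (λ v v∈S → trans (sym (form-⊙ w v D)) (w⊥S' _ (S⊙D⊆S' v∈S)))
            , (λ β m → sym (*-inverseʳ-cancel (DD'≈1 β m)))
    from : InScaled (Perp S) D' w → Perp S' w
    from (φ , φ⊥S , w≋φ⊙D') v v∈S' = begin
      form w v          ≈⟨ form-congˡ v w≋φ⊙D' ⟩
      form (φ ⊙₄ D') v  ≈⟨ sym (form-⊙ φ v D') ⟩
      form φ (v ⊙₄ D')  ≈⟨ φ⊥S _ (S'⊙D'⊆S v∈S') ⟩
      0#                ∎

  -- InLambda g h unfolds to Span (lam g h), and InPerp g h to Perp (InLambda g h).
  Span : ∀ {n} → (Fin n → Fin n → Vect4 n) → Vect4 n → Set (c ⊔ ℓ)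
  Span {n} L v = ∃ λ (coef : Fin n → Fin n → Carrier) →
    v ≋₄ (λ β m → sumF n (λ j → sumF n (λ k → coef j k * L j k β m)))

  Span-⊙ : ∀ {n} {L L' : Fin n → Fin n → Vect4 n} {D : Vect4 n} (t : Fin n → Fin n → Carrier)
    → (∀ j k β m → L j k β m * D β m ≈ t j k * L' j k β m)
    → ∀ {v} → Span L v → Span L' (v ⊙₄ D)
  Span-⊙ {n} {L} {L'} {D} t L⊙D≈tL' {v} (coef , v≋ΣcoefL) =
    (λ j k → coef j k * t j k) , λ β m → begin
      v β m * D β m
        ≈⟨ *-congʳ (v≋ΣcoefL β m) ⟩
      sumF n (λ j → sumF n (λ k → coef j k * L j k β m)) * D β m
        ≈⟨ sumF-*ʳ n _ (D β m) ⟩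
      sumF n (λ j → sumF n (λ k → coef j k * L j k β m) * D β m)
        ≈⟨ sumF-cong n (λ j → sumF-*ʳ n _ (D β m)) ⟩
      sumF n (λ j → sumF n (λ k → (coef j k * L j k β m) * D β m))
        ≈⟨ sumF-cong n (λ j → sumF-cong n (λ k → summand j k β m)) ⟩
      sumF n (λ j → sumF n (λ k → (coef j k * t j k) * L' j k β m))
    ∎
    where
    summand : ∀ j k β m → (coef j k * L j k β m) * D β m ≈ (coef j k * t j k) * L' j k β m
    summand j k β m = begin
      (coef j k * L j k β m) * D β m  ≈⟨ *-assoc _ _ _ ⟩
      coef j k * (L j k β m * D β m)  ≈⟨ *-congˡ (L⊙D≈tL' j k β m) ⟩
      coef j k * (t j k * L' j k β m) ≈⟨ sym (*-assoc _ _ _) ⟩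
      (coef j k * t j k) * L' j k β m ∎

  Rescaled : ∀ {n} → Carrier → Vect n → Vect n → Vect n → Set ℓ
  Rescaled a f x x' = ∀ m → x' m ≈ a * (x m * f m)

  Rescaled₄ : ∀ {n} → Carrier → Vect4 n → Vect4 n → Vect4 n → Set ℓ
  Rescaled₄ a D φ φ' = ∀ β → Rescaled a (D β) (φ β) (φ' β)

  Perp-Span-rescaled : ∀ {n} {L L' : Fin n → Fin n → Vect4 n} {D D' : Vect4 n}
    {s s' : Fin n → Fin n → Carrier}
    → (∀ j k → Rescaled₄ (s j k) D (L j k) (L' j k))
    → (∀ j k → s j k * s' j k ≈ 1#)
    → (∀ β m → D β m * D' β m ≈ 1#)
    → Perp (Span L') ≐ InScaled (Perp (Span L)) D'
  Perp-Span-rescaled {L = L} {L'} {D} {D'} {s} {s'} L'≈sL⊙D ss'≈1 DD'≈1 =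
    Perp-⊙ (Span-⊙ s' L⊙D≈s'L') (Span-⊙ s L'⊙D'≈sL) DD'≈1
    where
    L⊙D≈s'L' : ∀ j k β m → L j k β m * D β m ≈ s' j k * L' j k β m
    L⊙D≈s'L' j k β m = sym (begin
      s' j k * L' j k β m                  ≈⟨ *-congˡ (L'≈sL⊙D j k β m) ⟩
      s' j k * (s j k * (L j k β m * D β m)) ≈⟨ *-inverseˡ-cancel (ss'≈1 j k) ⟩
      L j k β m * D β m                    ∎)
    L'⊙D'≈sL : ∀ j k β m → L' j k β m * D' β m ≈ s j k * L j k β m
    L'⊙D'≈sL j k β m = begin
      L' j k β m * D' β m                    ≈⟨ *-congʳ (L'≈sL⊙D j k β m) ⟩
      (s j k * (L j k β m * D β m)) * D' β m ≈⟨ *-assoc _ _ _ ⟩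
      s j k * ((L j k β m * D β m) * D' β m) ≈⟨ *-congˡ (*-inverseʳ-cancel (DD'≈1 β m)) ⟩
      s j k * L j k β m                      ∎

  ⊙-rescaledˡ : ∀ {n} {a} {f x x' : Vect n} (y : Vect n)
    → Rescaled a f x x' → Rescaled a f (x ⊙ y) (x' ⊙ y)
  ⊙-rescaledˡ {a = a} {f} {x} y x'≈ m = trans (*-congʳ (x'≈ m))
    (solve 4 (λ a x f y → (a ⊕ (x ⊕ f)) ⊕ y ⊜ a ⊕ ((x ⊕ y) ⊕ f)) refl a (x m) (f m) (y m))

  ⊙-rescaledʳ : ∀ {n} {a} {f y y' : Vect n} (x : Vect n)
    → Rescaled a f y y' → Rescaled a f (x ⊙ y) (x ⊙ y')
  ⊙-rescaledʳ {a = a} {f} {y} x y'≈ m = trans (*-congˡ (y'≈ m))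
    (solve 4 (λ a x f y → x ⊕ (a ⊕ (y ⊕ f)) ⊜ a ⊕ ((x ⊕ y) ⊕ f)) refl a (x m) (f m) (y m))

  quad-rescaled : ∀ {n} {a} {X Y Z T X' Y' Z' T' f₁ f₂ f₃ f₄ : Vect n}
    → Rescaled a f₁ X X' → Rescaled a f₂ Y Y' → Rescaled a f₃ Z Z' → Rescaled a f₄ T T'
    → Rescaled₄ a (quad f₁ f₂ f₃ f₄) (quad X Y Z T) (quad X' Y' Z' T')
  quad-rescaled X' Y' Z' T' fz                = X'
  quad-rescaled X' Y' Z' T' (fs fz)           = Y'
  quad-rescaled X' Y' Z' T' (fs (fs fz))      = Z'
  quad-rescaled X' Y' Z' T' (fs (fs (fs fz))) = T'

  quad-inverse : ∀ {n} {X Y Z T X' Y' Z' T' : Vect n}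
    → (∀ m → X m * X' m ≈ 1#) → (∀ m → Y m * Y' m ≈ 1#)
    → (∀ m → Z m * Z' m ≈ 1#) → (∀ m → T m * T' m ≈ 1#)
    → ∀ β m → quad X Y Z T β m * quad X' Y' Z' T' β m ≈ 1#
  quad-inverse XX' YY' ZZ' TT' fz                = XX'
  quad-inverse XX' YY' ZZ' TT' (fs fz)           = YY'
  quad-inverse XX' YY' ZZ' TT' (fs (fs fz))      = ZZ'
  quad-inverse XX' YY' ZZ' TT' (fs (fs (fs fz))) = TT'

  ⊙₄-bijective : ∀ {n} {u u' : Vect4 n} → (∀ β m → u β m * u' β m ≈ 1#)
    → Bijective _≋₄_ _≋₄_ (_⊙₄ u)
  ⊙₄-bijective {u = u} {u'} uu'≈1 = injective , surjective
    where
    injective : ∀ {x y} → (x ⊙₄ u) ≋₄ (y ⊙₄ u) → x ≋₄ y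
    injective {x} {y} xu≋yu β m = begin
      x β m                   ≈⟨ sym (*-inverseʳ-cancel (uu'≈1 β m)) ⟩
      (x β m * u β m) * u' β m ≈⟨ *-congʳ (xu≋yu β m) ⟩
      (y β m * u β m) * u' β m ≈⟨ *-inverseʳ-cancel (uu'≈1 β m) ⟩
      y β m                   ∎
    surjective : ∀ y → ∃ λ x → ∀ {z} → z ≋₄ x → (z ⊙₄ u) ≋₄ y
    surjective y = y ⊙₄ u' , λ {z} z≋yu' β m → begin
      z β m * u β m              ≈⟨ *-congʳ (z≋yu' β m) ⟩
      (y β m * u' β m) * u β m   ≈⟨ *-congʳ (*-comm _ _) ⟩
      (u' β m * y β m) * u β m   ≈⟨ *-comm _ _ ⟩
      u β m * (u' β m * y β m)   ≈⟨ *-inverseˡ-cancel (trans (*-comm _ _) (uu'≈1 β m)) ⟩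
      y β m                      ∎

  fv-inverse : ∀ {n} {x y} → x * y ≈ 1# → (i m : Fin n) → fv x i m * fv y i m ≈ 1#
  fv-inverse xy≈1 i m with i ≟ m
  ... | yes _ = xy≈1
  ... | no _  = *-identityʳ 1#

  fv-diag : ∀ {n} x (i : Fin n) → fv x i i ≡ x
  fv-diag x i rewrite dec-true (i ≟ i) ≡.refl = ≡.refl

  fv-off : ∀ {n} x {i m : Fin n} → i ≢ m → fv x i m ≡ 1#
  fv-off x {i} {m} i≢m rewrite dec-false (i ≟ m) i≢m = ≡.refl

  e-⊙-fv : ∀ {n} x (i j m : Fin n) → e j m * fv x i m ≈ fv x i j * e j m
  e-⊙-fv x i j m with j ≟ m
  ... | yes ≡.refl = *-comm 1# (fv x i j)
  ... | no _       = trans (zeroˡ _) (sym (zeroʳ _))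

  e-rescaled : ∀ {n} {b b'} (i j : Fin n) → b * b' ≈ 1# → Rescaled (fv b i j) (fv b' i) (e j) (e j)
  e-rescaled {b = b} {b'} i j bb'≈1 m = sym (begin
    fv b i j * (e j m * fv b' i m)  ≈⟨ *-congˡ (e-⊙-fv b' i j m) ⟩
    fv b i j * (fv b' i j * e j m)  ≈⟨ sym (*-assoc _ _ _) ⟩
    (fv b i j * fv b' i j) * e j m  ≈⟨ *-congʳ (fv-inverse bb'≈1 i j) ⟩
    1# * e j m                      ≈⟨ *-identityˡ _ ⟩
    e j m                           ∎)

  circ-rescaled : ∀ {n} {g : Matrix n} (b : Carrier) (i j : Fin n) → (∀ j → g j j ≈ 0#)
    → Rescaled (fv b i j) (fv b i) (g j) (circ g b i j)
  circ-rescaled {g = g} b i j g-diag m with j ≟ m | j ≟ i | m ≟ i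
  ... | yes ≡.refl | _ | _ =
    sym (trans (*-congˡ (trans (*-congʳ (g-diag j)) (zeroˡ _))) (zeroʳ _))
  ... | no j≢m | yes ≡.refl | _ rewrite fv-diag b j | fv-off b j≢m =
    *-congˡ (sym (*-identityʳ _))
  ... | no _ | no j≢i | yes ≡.refl rewrite fv-diag b i | fv-off b (j≢i ∘ ≡.sym) =
    trans (*-comm b _) (sym (*-identityˡ _))
  ... | no _ | no j≢i | no m≢i rewrite fv-off b (j≢i ∘ ≡.sym) | fv-off b (m≢i ∘ ≡.sym) =
    sym (trans (*-identityˡ _) (*-identityʳ _))

  lam-circˡ : ∀ {n} {g : Matrix n} (h : Matrix n) {b b'} (i j k : Fin n)
    → (∀ j → g j j ≈ 0#) → b * b' ≈ 1#
    → Rescaled₄ (fv b i j) (quad (fv b i) (fv b i) (fv b' i) (fv b' i))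
                (lam g h j k) (lam (circ g b i) h j k)
  lam-circˡ h {b} i j k g-diag bb'≈1 = quad-rescaled
    (⊙-rescaledˡ (h k) (circ-rescaled b i j g-diag)) (⊙-rescaledˡ (e k) (circ-rescaled b i j g-diag))
    (⊙-rescaledˡ (h k) (e-rescaled i j bb'≈1))      (⊙-rescaledˡ (e k) (e-rescaled i j bb'≈1))

  lam-circʳ : ∀ {n} (g : Matrix n) {h : Matrix n} {b b'} (i j k : Fin n)
    → (∀ j → h j j ≈ 0#) → b * b' ≈ 1#
    → Rescaled₄ (fv b i k) (quad (fv b i) (fv b' i) (fv b i) (fv b' i))
                (lam g h j k) (lam g (circ h b i) j k)
  lam-circʳ g {b = b} i j k h-diag bb'≈1 = quad-rescaled
    (⊙-rescaledʳ (g j) (circ-rescaled b i k h-diag)) (⊙-rescaledʳ (g j) (e-rescaled i k bb'≈1))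
    (⊙-rescaledʳ (e j) (circ-rescaled b i k h-diag)) (⊙-rescaledʳ (e j) (e-rescaled i k bb'≈1))

  InPerp-circˡ : ∀ {n} {g : Matrix n} (h : Matrix n) {b} (i : Fin n)
    → (∀ j → g j j ≈ 0#) → ¬ (b ≈ 0#)
    → InPerp (circ g b i) h
      ≐ InScaled (InPerp g h) (quad (fv (b ⁻¹) i) (fv (b ⁻¹) i) (fv b i) (fv b i))
  InPerp-circˡ h {b} i g-diag b≉0 =
    Perp-Span-rescaled (λ j k → lam-circˡ h i j k g-diag bb⁻¹≈1)
      (λ j k → fv-inverse bb⁻¹≈1 i j)
      (quad-inverse (fv-inverse bb⁻¹≈1 i) (fv-inverse bb⁻¹≈1 i)
                    (fv-inverse b⁻¹b≈1 i) (fv-inverse b⁻¹b≈1 i))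
    where
    bb⁻¹≈1 = ⁻¹-inverse b b≉0
    b⁻¹b≈1 = ⁻¹-inverseˡ b≉0

  InPerp-circʳ : ∀ {n} (g : Matrix n) {h : Matrix n} {b} (i : Fin n)
    → (∀ j → h j j ≈ 0#) → ¬ (b ≈ 0#)
    → InPerp g (circ h b i)
      ≐ InScaled (InPerp g h) (quad (fv (b ⁻¹) i) (fv b i) (fv (b ⁻¹) i) (fv b i))
  InPerp-circʳ g {b = b} i h-diag b≉0 =
    Perp-Span-rescaled (λ j k → lam-circʳ g i j k h-diag bb⁻¹≈1)
      (λ j k → fv-inverse bb⁻¹≈1 i k)
      (quad-inverse (fv-inverse bb⁻¹≈1 i) (fv-inverse b⁻¹b≈1 i)
                    (fv-inverse bb⁻¹≈1 i) (fv-inverse b⁻¹b≈1 i))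
    where
    bb⁻¹≈1 = ⁻¹-inverse b b≉0
    b⁻¹b≈1 = ⁻¹-inverseˡ b≉0

mainTheorem5 : ∀ {c ℓ} (F : Field c ℓ) (q : ℕ)
    → Bijection (Field.setoid F) (setoid (Fin q))
    → (∃₂ λ p k → Prime p × p ≢ 2 × 1 ≤ k × q ≡ p ^ k)
    → ∀ (n : ℕ) (G H : Over.Matrix F n)
    → Over.IsLabeledGraph F G → Over.IsLabeledGraph F H
    → ∀ (i : Fin n)
    → (∀ b₁ b₂ b₃ b₄ → ¬ (Field._≈_ F b₁ (Field.0# F)) → ¬ (Field._≈_ F b₂ (Field.0# F))
         → ¬ (Field._≈_ F b₃ (Field.0# F)) → ¬ (Field._≈_ F b₄ (Field.0# F))
         → Bijective (Over._≋₄_ F) (Over._≋₄_ F)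
             (λ φ → Over._⊙₄_ F φ (Over.quad F (Over.fv F b₁ i) (Over.fv F b₂ i)
                                              (Over.fv F b₃ i) (Over.fv F b₄ i))))
    × (∀ b → ¬ (Field._≈_ F b (Field.0# F))
         → Over._≐_ F (Over.InPerp F (Over.circ F G b i) H)
             (Over.InScaled F (Over.InPerp F G H)
               (Over.quad F (Over.fv F (Field._⁻¹ F b) i) (Over.fv F (Field._⁻¹ F b) i)
                            (Over.fv F b i) (Over.fv F b i))))
    × (∀ b → ¬ (Field._≈_ F b (Field.0# F))
         → Over._≐_ F (Over.InPerp F G (Over.circ F H b i))
             (Over.InScaled F (Over.InPerp F G H)
               (Over.quad F (Over.fv F (Field._⁻¹ F b) i) (Over.fv F b i)
                            (Over.fv F (Field._⁻¹ F b) i) (Over.fv F b i))))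
mainTheorem5 F _ _ _ n G H (_ , G-diag) (_ , H-diag) i =
    (λ b₁ b₂ b₃ b₄ b₁≉0 b₂≉0 b₃≉0 b₄≉0 → ⊙₄-bijective F
      (quad-inverse F (fv-invertible b₁≉0) (fv-invertible b₂≉0)
                      (fv-invertible b₃≉0) (fv-invertible b₄≉0)))
  , (λ b b≉0 → InPerp-circˡ F H i G-diag b≉0)
  , (λ b b≉0 → InPerp-circʳ F G i H-diag b≉0)
  where
  open Field F using (_≈_; _*_; 0#; 1#; _⁻¹; ⁻¹-inverse)
  open Over F using (fv)
  fv-invertible : ∀ {b} → ¬ (b ≈ 0#) → ∀ m → fv b i m * fv (b ⁻¹) i m ≈ 1#
  fv-invertible {b} b≉0 = fv-inverse F (⁻¹-inverse b b≉0) i
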